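{- Let $F=01001010\cdots$ be the Fibonacci word, the fixed point of the morphism $0\mapsto 01$, $1\mapsto 0$. Let $w\colon\mathbb{N}^2\to\{0,1\}$ be defined by: for each $j\in\mathbb{N}$, the row $(w(i,j))_{i\in\mathbb{N}}$ equals $1F$ if $j$ is even and $0F$ if $j$ is odd. Then every row $(w(i,j))_{i\in\mathbb{N}}$ and every column $(w(i,j))_{j\in\mathbb{N}}$ of $w$ is a uniformly recurrent one-dimensional word, but $w$ is not uniformly recurrent (not UR).
   Context: $\mathbb{N}=\{0,1,\ldots\}$. A one-dimensional word is uniformly recurrent if every prefix occurs in it with bounded gaps (every length-$b$ factor contains it, for some $b$). For a bidimensional word $w\colon\mathbb{N}^2\to A$, a finite word $f$ of size $(s_1,s_2)$ (a map on $\{0,\ldots,s_1-1\}\times\{0,\ldots,s_2-1\}$) is a factor of $w$, occurring at position $\mathbf{p}$, if $f(\mathbf{i})=w(\mathbf{p}+\mathbf{i})$ for all $\mathbf{i}$; it is a prefix if $\mathbf{p}=(0,0)$. A factor of a finite block is defined analogously. $w$ is UR if for every prefix $p$ of $w$ there is $b\ge1$ such that every factor of $w$ of size $(b,b)$ contains $p$ as a factor. -}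

module Defs where

open import Data.Nat using (ℕ; zero; suc; _+_; _≤_; _<_)
open import Data.Fin using (Fin)
open import Data.List using (List; []; _∷_; _++_; concatMap)
open import Data.Product using (_×_; ∃; ∃-syntax)
open import Relation.Binary.PropositionalEquality using (_≡_)
open import Function using (_∘_)

Bin : Set
Bin = Fin 2

φ₁ : Bin → List Bin
φ₁ Fin.zero = Fin.zero ∷ Fin.suc Fin.zero ∷ []
φ₁ (Fin.suc _) = Fin.zero ∷ []

φ : List Bin → List Bin
φ = concatMap φ₁

φ^ : ℕ → List Bin
φ^ zero = Fin.zero ∷ []
φ^ (suc k) = φ (φ^ k)

-- n-th letter of a finite word (with a default beyond its end)
nth : List Bin → ℕ → Bin
nth [] _ = Fin.zero
nth (x ∷ xs) zero = x
nth (x ∷ xs) (suc n) = nth xs n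

-- The Fibonacci word F = 01001010…, the fixed point of φ (limit of φ^k(0)).
-- Since |φ^k(0)| ≥ k+1 and φ^k(0) is a prefix of φ^(k+1)(0),
-- F(n) is the n-th letter of φ^(n+1)(0).
fib : ℕ → Bin
fib n = nth (φ^ (suc n)) n

rowHead : ℕ → Bin
rowHead zero = Fin.suc Fin.zero
rowHead (suc zero) = Fin.zero
rowHead (suc (suc j)) = rowHead j

w : ℕ → ℕ → Bin
w zero j = rowHead j
w (suc i) j = fib i

UniformlyRecurrent₁ : {A : Set} → (ℕ → A) → Set
UniformlyRecurrent₁ u =
  ∀ (n : ℕ) → ∃[ b ] (1 ≤ b × ∀ (p : ℕ) → ∃[ k ] (k + n ≤ b ×
     (∀ (i : ℕ) → i < n → u (p + k + i) ≡ u i)))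

UR : {A : Set} → (ℕ → ℕ → A) → Set
UR v =
  ∀ (s₁ s₂ : ℕ) → ∃[ b ] (1 ≤ b × ∀ (p₁ p₂ : ℕ) → ∃[ k₁ ] ∃[ k₂ ]
     (k₁ + s₁ ≤ b × k₂ + s₂ ≤ b ×
      (∀ (i₁ i₂ : ℕ) → i₁ < s₁ → i₂ < s₂ →
         v (p₁ + k₁ + i₁) (p₂ + k₂ + i₂) ≡ v i₁ i₂)))

-- Since F = φ(F), F is the concatenation of the blocks φ(F t), the t-th one starting at
-- blockStart t. Every block begins with 0 and φ(x) ends with the letter opposite to x, so
-- applying φ to an occurrence of x · F[0, n) in F gives an occurrence of the opposite letter
-- followed by φ(F[0, n)) = F[0, blockStart n), ending just before the next block. As blockStart
-- grows by at most 2 per step, this preserves bounded gaps; starting from the block heads and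
-- iterating, y · u recurs with bounded gaps in F for each letter y and each prefix u of F,
-- which is the uniform recurrence of the rows 1F and 0F. The columns are periodic.
module Submission where

open import Defs
open import Data.Fin using (Fin; opposite)
open import Data.Fin.Properties using (opposite-involutive)
open import Data.List using ([]; _∷_; _++_; length)
open import Data.List.Properties using (++-assoc; ++-identityʳ; length-++)
open import Data.Nat
open import Data.Nat.Properties
open import Data.Product using (_×_; _,_; proj₁; ∃-syntax)
open import Function using (_∘_)
open import Relation.Nullary using (¬_; yes; no)
open import Relation.Binary.PropositionalEquality

pattern 𝟎 = Fin.zero
pattern 𝟏 = Fin.suc Fin.zero

φ-++ : ∀ xs ys → φ (xs ++ ys) ≡ φ xs ++ φ ys
φ-++ []       ys = refl
φ-++ (x ∷ xs) ys = trans (cong (φ₁ x ++_) (φ-++ xs ys)) (sym (++-assoc (φ₁ x) (φ xs) (φ ys)))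

φ^-suc-suc : ∀ k → φ^ (suc (suc k)) ≡ φ^ (suc k) ++ φ^ k
φ^-suc-suc zero    = refl
φ^-suc-suc (suc k) = trans (cong φ (φ^-suc-suc k)) (φ-++ (φ^ (suc k)) (φ^ k))

φ^-suc-extends : ∀ k → ∃[ ys ] φ^ (suc k) ≡ φ^ k ++ ys
φ^-suc-extends zero    = 𝟏 ∷ [] , refl
φ^-suc-extends (suc k) = φ^ k , φ^-suc-suc k

φ^-extends : ∀ k d → ∃[ ys ] φ^ (d + k) ≡ φ^ k ++ ys
φ^-extends k zero = [] , sym (++-identityʳ (φ^ k))
φ^-extends k (suc d) with φ^-extends k d | φ^-suc-extends (d + k)
... | ys , eq | zs , eq′ = ys ++ zs , (begin
  φ^ (suc d + k)      ≡⟨ eq′ ⟩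
  φ^ (d + k) ++ zs    ≡⟨ cong (_++ zs) eq ⟩
  (φ^ k ++ ys) ++ zs  ≡⟨ ++-assoc (φ^ k) ys zs ⟩
  φ^ k ++ ys ++ zs    ∎)
  where open ≡-Reasoning

length-φ^ : ∀ k → suc k ≤ length (φ^ k)
length-φ^ zero          = s≤s z≤n
length-φ^ (suc zero)    = s≤s (s≤s z≤n)
length-φ^ (suc (suc k)) = begin
  suc (suc (suc k))                         ≡⟨ +-comm 1 (suc (suc k)) ⟩
  suc (suc k) + 1                           ≤⟨ +-mono-≤ (length-φ^ (suc k)) (≤-trans (s≤s z≤n) (length-φ^ k)) ⟩
  length (φ^ (suc k)) + length (φ^ k)       ≡⟨ sym (length-++ (φ^ (suc k))) ⟩
  length (φ^ (suc k) ++ φ^ k)               ≡⟨ cong length (sym (φ^-suc-suc k)) ⟩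
  length (φ^ (suc (suc k)))                 ∎
  where open ≤-Reasoning

nth-++ˡ : ∀ xs ys {n} → n < length xs → nth (xs ++ ys) n ≡ nth xs n
nth-++ˡ (x ∷ xs) ys {zero}  _         = refl
nth-++ˡ (x ∷ xs) ys {suc n} (s≤s n<) = nth-++ˡ xs ys n<

nth-++ʳ : ∀ xs ys n → nth (xs ++ ys) (length xs + n) ≡ nth ys n
nth-++ʳ []       ys n = refl
nth-++ʳ (x ∷ xs) ys n = nth-++ʳ xs ys n

nth-φ^-extends : ∀ k d {n} → n < length (φ^ k) → nth (φ^ (d + k)) n ≡ nth (φ^ k) n
nth-φ^-extends k d n< with φ^-extends k d
... | ys , eq = trans (cong (λ xs → nth xs _) eq) (nth-++ˡ (φ^ k) ys n<)

nth-φ^ : ∀ k {n} → n < length (φ^ k) → nth (φ^ k) n ≡ fib n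
nth-φ^ k {n} n< = begin
  nth (φ^ k) n            ≡⟨ sym (nth-φ^-extends k (suc n) n<) ⟩
  nth (φ^ (suc n + k)) n  ≡⟨ cong (λ m → nth (φ^ m) n) (+-comm (suc n) k) ⟩
  nth (φ^ (k + suc n)) n  ≡⟨ nth-φ^-extends (suc n) k (≤-trans (n≤1+n (suc n)) (length-φ^ (suc n))) ⟩
  fib n                   ∎
  where open ≡-Reasoning

blockLength : Bin → ℕ
blockLength x = length (φ₁ x)

1≤blockLength : ∀ x → 1 ≤ blockLength x
1≤blockLength 𝟎 = s≤s z≤n
1≤blockLength 𝟏 = s≤s z≤n

blockLength≤2 : ∀ x → blockLength x ≤ 2
blockLength≤2 𝟎 = ≤-refl
blockLength≤2 𝟏 = s≤s z≤n

-- offset g t = |φ(g 0 ⋯ g (t - 1))|, the position of the block φ(g t) in φ(g)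
offset : (ℕ → Bin) → ℕ → ℕ
offset g zero    = 0
offset g (suc t) = blockLength (g 0) + offset (g ∘ suc) t

offset-suc : ∀ g t → offset g (suc t) ≡ offset g t + blockLength (g t)
offset-suc g zero    = +-comm (blockLength (g 0)) 0
offset-suc g (suc t) = trans (cong (blockLength (g 0) +_) (offset-suc (g ∘ suc) t))
                             (sym (+-assoc (blockLength (g 0)) _ _))

offset-<-suc : ∀ g t → offset g t < offset g (suc t)
offset-<-suc g t = begin-strict
  offset g t                      <⟨ m<m+n (offset g t) (1≤blockLength (g t)) ⟩
  offset g t + blockLength (g t)  ≡⟨ sym (offset-suc g t) ⟩
  offset g (suc t)                ∎
  where open ≤-Reasoning

offset-suc-≤ : ∀ g t → offset g (suc t) ≤ offset g t + 2
offset-suc-≤ g t = ≤-trans (≤-reflexive (offset-suc g t)) (+-monoʳ-≤ (offset g t) (blockLength≤2 (g t)))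

offset-mono : ∀ g {a b} → a ≤ b → offset g a ≤ offset g b
offset-mono g a≤b = go (≤⇒≤′ a≤b)
  where
  go : ∀ {a b} → a ≤′ b → offset g a ≤ offset g b
  go ≤′-refl                   = ≤-refl
  go {b = suc b} (≤′-step a≤b) = ≤-trans (go a≤b) (<⇒≤ (offset-<-suc g b))

offset-+-≤ : ∀ g a d → offset g (a + d) ≤ offset g a + (d + d)
offset-+-≤ g a zero    = ≤-reflexive (trans (cong (offset g) (+-identityʳ a)) (sym (+-identityʳ _)))
offset-+-≤ g a (suc d) = begin
  offset g (a + suc d)                ≡⟨ cong (offset g) (+-suc a d) ⟩
  offset g (suc (a + d))              ≤⟨ offset-suc-≤ g (a + d) ⟩
  offset g (a + d) + 2                ≤⟨ +-monoˡ-≤ 2 (offset-+-≤ g a d) ⟩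
  offset g a + (d + d) + 2            ≡⟨ +-assoc (offset g a) (d + d) 2 ⟩
  offset g a + (d + d + 2)            ≡⟨ cong (offset g a +_) (trans (+-comm (d + d) 2) (cong suc (sym (+-suc d d)))) ⟩
  offset g a + (suc d + suc d)        ∎
  where open ≤-Reasoning

offset-covers : ∀ g p → ∃[ t ] (p ≤ offset g t × offset g t ≤ suc p)
offset-covers g zero = 0 , z≤n , z≤n
offset-covers g (suc p) with offset-covers g p
... | t , p≤ , ≤1+p with suc p ≤? offset g t
...   | yes 1+p≤ = t , 1+p≤ , m≤n⇒m≤1+n ≤1+p
...   | no  1+p≰ = suc t , ≤-trans (s≤s p≤) (offset-<-suc g t) , (begin
  offset g (suc t)  ≤⟨ offset-suc-≤ g t ⟩
  offset g t + 2    ≤⟨ +-monoˡ-≤ 2 (≮⇒≥ 1+p≰) ⟩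
  p + 2             ≡⟨ +-comm p 2 ⟩
  suc (suc p)       ∎)
  where open ≤-Reasoning

offset-decompose : ∀ g n {j} → j < offset g n →
                   ∃[ i ] ∃[ e ] (i < n × e < blockLength (g i) × j ≡ offset g i + e)
offset-decompose g (suc n) {j} j< with j <? offset g n
... | yes j<′ with offset-decompose g n j<′
...   | i , e , i< , e< , eq = i , e , m<n⇒m<1+n i< , e< , eq
offset-decompose g (suc n) {j} j< | no j≮ =
  n , j ∸ offset g n , n<1+n n ,
  +-cancelˡ-< (offset g n) _ _ (subst (_< offset g n + blockLength (g n)) (sym split) (subst (j <_) (offset-suc g n) j<)) ,
  sym split
  where
  split : offset g n + (j ∸ offset g n) ≡ j
  split = m+[n∸m]≡n (≮⇒≥ j≮)

offset-+ : ∀ g t n → (∀ i → i < n → g (t + i) ≡ g i) → offset g (t + n) ≡ offset g t + offset g n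
offset-+ g t zero    _     = trans (cong (offset g) (+-identityʳ t)) (sym (+-identityʳ (offset g t)))
offset-+ g t (suc n) shift = begin
  offset g (t + suc n)                          ≡⟨ cong (offset g) (+-suc t n) ⟩
  offset g (suc (t + n))                        ≡⟨ offset-suc g (t + n) ⟩
  offset g (t + n) + blockLength (g (t + n))    ≡⟨ cong₂ _+_ (offset-+ g t n (λ i i< → shift i (m<n⇒m<1+n i<)))
                                                             (cong blockLength (shift n (n<1+n n))) ⟩
  offset g t + offset g n + blockLength (g n)   ≡⟨ +-assoc (offset g t) (offset g n) _ ⟩
  offset g t + (offset g n + blockLength (g n)) ≡⟨ cong (offset g t +_) (sym (offset-suc g n)) ⟩
  offset g t + offset g (suc n)                 ∎
  where open ≡-Reasoning

offset-≤ : ∀ g t → offset g t ≤ t + t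
offset-≤ g = offset-+-≤ g 0

nth-φ-offset : ∀ g xs → (∀ {u} → u < length xs → nth xs u ≡ g u) →
               ∀ {t j} → t < length xs → j < blockLength (g t) →
               nth (φ xs) (offset g t + j) ≡ nth (φ₁ (g t)) j
nth-φ-offset g (x ∷ xs) agree {zero} {j} _ j<
  rewrite sym (agree {0} z<s) = nth-++ˡ (φ₁ x) (φ xs) j<
nth-φ-offset g (x ∷ xs) agree {suc t} {j} (s≤s t<) j<
  rewrite sym (agree {0} z<s) = begin
  nth (φ₁ x ++ φ xs) (blockLength x + offset (g ∘ suc) t + j)   ≡⟨ cong (nth (φ₁ x ++ φ xs)) (+-assoc (blockLength x) _ j) ⟩
  nth (φ₁ x ++ φ xs) (blockLength x + (offset (g ∘ suc) t + j)) ≡⟨ nth-++ʳ (φ₁ x) (φ xs) _ ⟩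
  nth (φ xs) (offset (g ∘ suc) t + j)                           ≡⟨ nth-φ-offset (g ∘ suc) xs (λ u< → agree (s≤s u<)) t< j< ⟩
  nth (φ₁ (g (suc t))) j                                        ∎
  where open ≡-Reasoning

offset-length : ∀ g xs → (∀ {u} → u < length xs → nth xs u ≡ g u) → offset g (length xs) ≡ length (φ xs)
offset-length g []       _     = refl
offset-length g (x ∷ xs) agree = begin
  blockLength (g 0) + offset (g ∘ suc) (length xs)  ≡⟨ cong₂ _+_ (cong blockLength (sym (agree z<s)))
                                                                (offset-length (g ∘ suc) xs (λ u< → agree (s≤s u<))) ⟩
  length (φ₁ x) + length (φ xs)                     ≡⟨ sym (length-++ (φ₁ x)) ⟩
  length (φ (x ∷ xs))                               ∎
  where open ≡-Reasoning

blockStart : ℕ → ℕ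
blockStart = offset fib

fib-block : ∀ t {j} → j < blockLength (fib t) → fib (blockStart t + j) ≡ nth (φ₁ (fib t)) j
fib-block t {j} j< =
  trans (sym (nth-φ^ (suc (t + t)) in-range)) (nth-φ-offset fib (φ^ (t + t)) (nth-φ^ (t + t)) t< j<)
  where
  t< : t < length (φ^ (t + t))
  t< = ≤-trans (s≤s (m≤m+n t t)) (length-φ^ (t + t))
  in-range : blockStart t + j < length (φ^ (suc (t + t)))
  in-range = begin-strict
    blockStart t + j                    <⟨ +-monoʳ-< (blockStart t) j< ⟩
    blockStart t + blockLength (fib t)  ≡⟨ sym (offset-suc fib t) ⟩
    blockStart (suc t)                  ≤⟨ offset-≤ fib (suc t) ⟩
    suc t + suc t                       ≡⟨ cong suc (+-suc t t) ⟩
    suc (suc (t + t))                   ≤⟨ length-φ^ (suc (t + t)) ⟩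
    length (φ^ (suc (t + t)))           ∎
    where open ≤-Reasoning

fib-block-head : ∀ t → fib (blockStart t) ≡ 𝟎
fib-block-head t with fib t | fib-block t
... | 𝟎 | block = trans (cong fib (sym (+-identityʳ (blockStart t)))) (block z<s)
... | 𝟏 | block = trans (cong fib (sym (+-identityʳ (blockStart t)))) (block z<s)

fib-block-last : ∀ t → ∃[ r ] (blockStart t ≤ r × suc r ≡ blockStart (suc t) × fib r ≡ opposite (fib t))
fib-block-last t with fib t | offset-suc fib t | fib-block t
... | 𝟎 | blockStart-suc | block =
  blockStart t + 1 , m≤m+n _ 1 , trans (sym (+-suc (blockStart t) 1)) (sym blockStart-suc) , block ≤-refl
... | 𝟏 | blockStart-suc | block =
  blockStart t , ≤-refl , trans (+-comm 1 (blockStart t)) (sym blockStart-suc) ,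
  trans (cong fib (sym (+-identityʳ (blockStart t)))) (block z<s)

fib-φ-factor : ∀ t n → (∀ i → i < n → fib (t + i) ≡ fib i) →
               ∀ j → j < blockStart n → fib (blockStart t + j) ≡ fib j
fib-φ-factor t n factor j j< with offset-decompose fib n j<
... | i , e , i<n , e< , refl = begin
  fib (blockStart t + (blockStart i + e))   ≡⟨ cong fib (sym (+-assoc (blockStart t) (blockStart i) e)) ⟩
  fib (blockStart t + blockStart i + e)     ≡⟨ cong (λ o → fib (o + e)) (sym (offset-+ fib t i (λ i′ i′< → factor i′ (<-trans i′< i<n)))) ⟩
  fib (blockStart (t + i) + e)              ≡⟨ fib-block (t + i) (subst (λ x → e < blockLength x) (sym (factor i i<n)) e<) ⟩
  nth (φ₁ (fib (t + i))) e                  ≡⟨ cong (λ x → nth (φ₁ x) e) (factor i i<n) ⟩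
  nth (φ₁ (fib i)) e                        ≡⟨ sym (fib-block i e<) ⟩
  fib (blockStart i + e)                    ∎
  where open ≡-Reasoning

Occurs : Bin → ℕ → ℕ → Set
Occurs y n r = fib r ≡ y × (∀ i → i < n → fib (suc r + i) ≡ fib i)

occurs-shorter : ∀ {y m n} → m ≤ n → ∀ r → Occurs y n r → Occurs y m r
occurs-shorter m≤n _ (letter , prefix) = letter , λ i i< → prefix i (<-≤-trans i< m≤n)

φ-occurrence : ∀ y n r′ → Occurs (opposite y) n r′ →
               ∃[ r ] (blockStart r′ ≤ r × suc r ≡ blockStart (suc r′) × Occurs y (blockStart n) r × fib (suc r) ≡ 𝟎)
φ-occurrence y n r′ (letter , prefix) with fib-block-last r′
... | r , ≤r , suc-r≡ , last =
  r , ≤r , suc-r≡ , (y-at-r , prefix-after-r) , trans (cong fib suc-r≡) (fib-block-head (suc r′))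
  where
  y-at-r : fib r ≡ y
  y-at-r = trans last (trans (cong opposite letter) (opposite-involutive y))
  prefix-after-r : ∀ i → i < blockStart n → fib (suc r + i) ≡ fib i
  prefix-after-r i i< = trans (cong (λ s → fib (s + i)) suc-r≡) (fib-φ-factor (suc r′) n prefix i i<)

Syndetic : (ℕ → Set) → Set
Syndetic P = ∃[ G ] ∀ p → ∃[ r ] (p ≤ r × r ≤ p + G × P r)

syndetic-mono : ∀ {P Q : ℕ → Set} → (∀ r → P r → Q r) → Syndetic P → Syndetic Q
syndetic-mono P⇒Q (G , occ) = G , λ p → let r , p≤r , r≤ , Pr = occ p in r , p≤r , r≤ , P⇒Q r Pr

syndetic-suc : ∀ {P : ℕ → Set} → Syndetic (P ∘ suc) → Syndetic P
syndetic-suc (G , occ) = suc G , λ p → let r , p≤r , r≤ , Pr = occ p in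
  suc r , m≤n⇒m≤1+n p≤r , ≤-trans (s≤s r≤) (≤-reflexive (sym (+-suc p G))) , Pr

syndetic⇒UniformlyRecurrent₁ : ∀ {A : Set} {u : ℕ → A} →
  (∀ n → Syndetic (λ r → ∀ i → i < n → u (r + i) ≡ u i)) → UniformlyRecurrent₁ u
syndetic⇒UniformlyRecurrent₁ {u = u} prefixes n with prefixes n
... | G , occ = suc G + n , s≤s z≤n , λ p → let r , p≤r , r≤ , match = occ p in
  r ∸ p , ≤-trans (+-monoˡ-≤ n (m≤n+o⇒m∸n≤o r p r≤)) (n≤1+n (G + n)) ,
  λ i i< → trans (cong (λ s → u (s + i)) (m+[n∸m]≡n p≤r)) (match i i<)

syndetic-φ : ∀ {P Q : ℕ → Set} →
             (∀ r′ → P r′ → ∃[ r ] (blockStart r′ ≤ r × suc r ≡ blockStart (suc r′) × Q r)) →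
             Syndetic P → Syndetic Q
syndetic-φ {P} {Q} image (G , occ) = suc G + suc G , go
  where
  go : ∀ p → ∃[ r ] (p ≤ r × r ≤ p + (suc G + suc G) × Q r)
  go p with offset-covers fib p
  ... | t , p≤ , ≤1+p with occ t
  ... | r′ , t≤r′ , r′≤ , Pr′ with image r′ Pr′
  ... | r , ≤r , suc-r≡ , Qr = r , ≤-trans p≤ (≤-trans (offset-mono fib t≤r′) ≤r) , s≤s⁻¹ bound , Qr
    where
    bound : suc r ≤ suc p + (suc G + suc G)
    bound = begin
      suc r                                ≡⟨ suc-r≡ ⟩
      blockStart (suc r′)                  ≤⟨ offset-mono fib (s≤s r′≤) ⟩
      blockStart (suc (t + G))             ≡⟨ cong blockStart (sym (+-suc t G)) ⟩
      blockStart (t + suc G)               ≤⟨ offset-+-≤ fib t (suc G) ⟩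
      blockStart t + (suc G + suc G)       ≤⟨ +-monoˡ-≤ (suc G + suc G) ≤1+p ⟩
      suc p + (suc G + suc G)              ∎
      where open ≤-Reasoning

fib-𝟎-syndetic : Syndetic (λ r → fib r ≡ 𝟎)
fib-𝟎-syndetic = 1 , go
  where
  go : ∀ p → ∃[ r ] (p ≤ r × r ≤ p + 1 × fib r ≡ 𝟎)
  go p with offset-covers fib p
  ... | t , p≤ , ≤1+p = blockStart t , p≤ , subst (blockStart t ≤_) (+-comm 1 p) ≤1+p , fib-block-head t

occurs-syndetic-0 : ∀ y → Syndetic (Occurs y 0)
occurs-syndetic-0 𝟎 = syndetic-mono (λ _ 𝟎-at-r → 𝟎-at-r , λ _ ()) fib-𝟎-syndetic
occurs-syndetic-0 𝟏 = syndetic-mono (λ _ → proj₁) (syndetic-φ (φ-occurrence 𝟏 0) (occurs-syndetic-0 𝟎))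

occurs-syndetic-1 : ∀ y → Syndetic (Occurs y 1)
occurs-syndetic-1 y = syndetic-mono extend (syndetic-φ (φ-occurrence y 0) (occurs-syndetic-0 (opposite y)))
  where
  extend : ∀ r → Occurs y 0 r × fib (suc r) ≡ 𝟎 → Occurs y 1 r
  extend r ((y-at-r , _) , 𝟎-after) =
    y-at-r , λ { zero _ → trans (cong (fib ∘ suc) (+-identityʳ r)) 𝟎-after ; (suc i) (s≤s ()) }

occurs-φ^-syndetic : ∀ k y → Syndetic (Occurs y (length (φ^ k)))
occurs-φ^-syndetic zero    y = occurs-syndetic-1 y
occurs-φ^-syndetic (suc k) y =
  subst (Syndetic ∘ Occurs y) (offset-length fib (φ^ k) (nth-φ^ k))
        (syndetic-mono (λ _ → proj₁) (syndetic-φ (φ-occurrence y (length (φ^ k))) (occurs-φ^-syndetic k (opposite y))))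

occurs-syndetic : ∀ n y → Syndetic (Occurs y n)
occurs-syndetic n y = syndetic-mono (occurs-shorter (≤-trans (n≤1+n n) (length-φ^ n))) (occurs-φ^-syndetic n y)

rows-UniformlyRecurrent₁ : ∀ j → UniformlyRecurrent₁ (λ i → w i j)
rows-UniformlyRecurrent₁ j =
  syndetic⇒UniformlyRecurrent₁ λ n → syndetic-suc (syndetic-mono (row-prefix n) (occurs-syndetic n (rowHead j)))
  where
  row-prefix : ∀ n r → Occurs (rowHead j) n r → ∀ i → i < n → w (suc r + i) j ≡ w i j
  row-prefix n r (head , _)   zero    _  = trans (cong fib (+-identityʳ r)) head
  row-prefix n r (_ , prefix) (suc i) i< = trans (cong fib (+-suc r i)) (prefix i (<-trans (n<1+n i) i<))

rowHead-2-periodic-syndetic : Syndetic (λ r → ∀ i → rowHead (r + i) ≡ rowHead i)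
rowHead-2-periodic-syndetic = 1 , go
  where
  go : ∀ p → ∃[ r ] (p ≤ r × r ≤ p + 1 × ∀ i → rowHead (r + i) ≡ rowHead i)
  go zero       = 0 , z≤n , z≤n , λ _ → refl
  go (suc zero) = 2 , s≤s z≤n , ≤-refl , λ _ → refl
  go (suc (suc p)) with go p
  ... | r , p≤r , r≤ , periodic = suc (suc r) , s≤s (s≤s p≤r) , s≤s (s≤s r≤) , periodic

columns-UniformlyRecurrent₁ : ∀ i → UniformlyRecurrent₁ (λ j → w i j)
columns-UniformlyRecurrent₁ zero    =
  syndetic⇒UniformlyRecurrent₁ λ _ → syndetic-mono (λ _ periodic i _ → periodic i) rowHead-2-periodic-syndetic
columns-UniformlyRecurrent₁ (suc i) =
  syndetic⇒UniformlyRecurrent₁ λ _ → 0 , λ p → p , ≤-refl , m≤m+n p 0 , λ _ _ → refl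

-- Every column but the first is constant, so the prefix of size (1,2) never recurs away from column 0.
¬UR-w : ¬ UR w
¬UR-w ur with ur 1 2
... | _ , _ , occurrence with occurrence 1 0
... | _ , _ , _ , _ , match with trans (sym (match 0 0 z<s z<s)) (match 0 1 z<s (s<s z<s))
... | ()

proposition2p4 : (∀ j → UniformlyRecurrent₁ (λ i → w i j))
    × (∀ i → UniformlyRecurrent₁ (λ j → w i j))
    × ¬ UR w
proposition2p4 = rows-UniformlyRecurrent₁ , columns-UniformlyRecurrent₁ , ¬UR-w
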